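{- If $A$ is a cycle-free atomic flow and $A\to_{\mathsf w}^\star B$, then $B$ is cycle-free.
   Context: An atomic flow is a finite directed acyclic graph whose vertices are labelled interaction (0 upper edges, 2 lower edges), cointeraction (2 upper, 0 lower), weakening (0,1), coweakening (1,0), contraction (2,1) or cocontraction (1,2); edges may also have a dangling upper or lower end (upper/lower edges of the flow); there is a polarity assignment in $\{+,-\}$ with equal polarities on the edges of a (co)contraction and distinct ones on the two edges of a (co)interaction. A path is a sequence of edges $\epsilon_1,\dots,\epsilon_h$ where the lower end of $\epsilon_i$ is the upper end of $\epsilon_{i+1}$, or the reverse of such a sequence. An $\mathsf{ai}$-path is either a path or (recursively) the concatenation $\epsilon_1,\dots,\epsilon_k,\epsilon_{k+1},\dots,\epsilon_h$ of an $\mathsf{ai}$-path ending at an interaction or cointeraction vertex $\nu$ and an $\mathsf{ai}$-path starting at $\nu$, with $\epsilon_k\neq\epsilon_{k+1}$. An $\mathsf{ai}$-cycle is an $\mathsf{ai}$-path from a vertex to itself in which no edge appears twice. A flow is cycle-free if it contains no $\mathsf{ai}$-cycle. System $\mathsf w$ consists of seven local rules: (1) a weakening whose lower edge is an upper edge of a contraction: delete both and that edge, merging the contraction's other upper edge with its lower edge; (2) dually a cocontraction one of whose lower edges is the upper edge of a coweakening: delete both and that edge, merging the remaining two edges; (3) a weakening whose lower edge is an upper edge of a cointeraction: delete both and that edge, the cointeraction's other upper edge becomes the upper edge of a new coweakening; (4) an interaction one of whose lower edges is the upper edge of a coweakening: delete both and that edge, the other lower edge becomes the lower edge of a new weakening;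 (5) a weakening whose lower edge is the upper edge of a coweakening: delete both and the edge; (6) a weakening whose lower edge is the upper edge of a cocontraction: delete both and that edge, each lower edge of the cocontraction gets a new weakening; (7) a contraction whose lower edge is the upper edge of a coweakening: delete both and that edge, each upper edge of the contraction gets a new coweakening. $\to_{\mathsf w}^\star$ is the reflexive–transitive closure of one-step rewriting by these rules. -}

module Defs where

open import Data.Nat using (ℕ)
open import Data.Fin using (Fin; zero; suc; _≟_)
open import Data.Bool using (Bool; true; false; _∨_; if_then_else_)
open import Data.Maybe using (Maybe; just; nothing)
import Data.Maybe.Properties as MP
open import Data.List using (List; []; _∷_; length; filter; map; allFin)
open import Data.List.Relation.Unary.Linked using (Linked)
open import Data.List.Relation.Unary.Unique.Propositional using (Unique)
open import Data.Product using (Σ; ∃; _×_; _,_; proj₁)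
open import Data.Sum using (_⊎_; inj₁; inj₂; [_,_])
open import Data.Unit using (⊤)
open import Data.Empty using (⊥)
open import Relation.Nullary using (¬_; does)
open import Relation.Nullary.Decidable using (⌊_⌋)
open import Relation.Binary.PropositionalEquality using (_≡_; _≢_)
open import Relation.Binary.Construct.Closure.ReflexiveTransitive using (Star)
open import Function.Definitions using (Injective)

data Kind : Set where
  interaction cointeraction weakening coweakening contraction cocontraction : Kind

data Pol : Set where
  plus minus : Pol

upArity : Kind → ℕ
upArity interaction   = 0
upArity cointeraction = 2
upArity weakening     = 0
upArity coweakening   = 1
upArity contraction   = 2
upArity cocontraction = 1

lowArity : Kind → ℕ
lowArity interaction   = 2
lowArity cointeraction = 0
lowArity weakening     = 1
lowArity coweakening   = 0
lowArity contraction   = 1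
lowArity cocontraction = 2

-- For an edge e, 'up e' is the vertex at its upper end (e is a lower edge of
-- that vertex) and 'down e' the vertex at its lower end (e is an upper edge of
-- that vertex); 'nothing' means the end is dangling (upper/lower edge of the flow).

record Raw : Set where
  field
    nV   : ℕ
    nE   : ℕ
    kind : Fin nV → Kind
    up   : Fin nE → Maybe (Fin nV)
    down : Fin nE → Maybe (Fin nV)
    pol  : Fin nE → Pol

module _ (R : Raw) where
  open Raw R

  _≟M_ : (x y : Maybe (Fin nV)) → Relation.Nullary.Dec (x ≡ y)
  _≟M_ = MP.≡-dec _≟_

  upperEdgeCount : Fin nV → ℕ
  upperEdgeCount v = length (filter (λ e → down e ≟M just v) (allFin nE))

  lowerEdgeCount : Fin nV → ℕ
  lowerEdgeCount v = length (filter (λ e → up e ≟M just v) (allFin nE))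

  data _⇝_ : Fin nV → Fin nV → Set where
    edge  : ∀ {v w} (e : Fin nE) → up e ≡ just v → down e ≡ just w → v ⇝ w
    _▸_   : ∀ {u v w} → u ⇝ v → v ⇝ w → u ⇝ w

  Incident : Fin nE → Fin nV → Set
  Incident e v = (up e ≡ just v) ⊎ (down e ≡ just v)

  record IsFlow : Set where
    field
      upper-arity : ∀ v → upperEdgeCount v ≡ upArity (kind v)
      lower-arity : ∀ v → lowerEdgeCount v ≡ lowArity (kind v)
      acyclic     : ∀ v → ¬ (v ⇝ v)
      pol-contr   : ∀ v → kind v ≡ contraction → ∀ e e' → Incident e v → Incident e' v → pol e ≡ pol e'
      pol-cocontr : ∀ v → kind v ≡ cocontraction → ∀ e e' → Incident e v → Incident e' v → pol e ≡ pol e'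
      pol-int     : ∀ v → kind v ≡ interaction → ∀ e e' → up e ≡ just v → up e' ≡ just v → e ≢ e' → pol e ≢ pol e'
      pol-coint   : ∀ v → kind v ≡ cointeraction → ∀ e e' → down e ≡ just v → down e' ≡ just v → e ≢ e' → pol e ≢ pol e'

  -- ai-paths and ai-cycles.
  -- A path is traversed edge by edge; a step is an edge with a direction
  -- (↓: from its upper end to its lower end, ↑: the reverse).

  data Dir : Set where
    ↓ ↑ : Dir

  Step : Set
  Step = Fin nE × Dir

  src : Step → Maybe (Fin nV)
  src (e , ↓) = up e
  src (e , ↑) = down e

  tgt : Step → Maybe (Fin nV)
  tgt (e , ↓) = down e
  tgt (e , ↑) = up e

  -- Two consecutive steps of an ai-path: they meet at a vertex ν; either they
  -- continue in the same direction (inside a path), or the direction turns at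
  -- a cointeraction (↓ then ↑) or an interaction (↑ then ↓) with distinct edges
  -- (the concatenation clause of the definition of ai-path).
  Link : Step → Step → Set
  Link (e , d) (e' , d') = Σ (Fin nV) λ ν → tgt (e , d) ≡ just ν × src (e' , d') ≡ just ν ×
    ( (d ≡ d')
    ⊎ (d ≡ ↓ × d' ≡ ↑ × kind ν ≡ cointeraction × e ≢ e')
    ⊎ (d ≡ ↑ × d' ≡ ↓ × kind ν ≡ interaction × e ≢ e') )

  lastStep : Step → List Step → Step
  lastStep s []       = s
  lastStep _ (t ∷ ts) = lastStep t ts

  record AiCycle : Set where
    field
      ν      : Fin nV
      first  : Step
      rest   : List Step
      linked : Linked Link (first ∷ rest)
      starts : src first ≡ just ν
      ends   : tgt (lastStep first rest) ≡ just ν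
      noRep  : Unique (map proj₁ (first ∷ rest))

  CycleFree : Set
  CycleFree = ¬ AiCycle

record Flow : Set where
  field
    raw : Raw
    wf  : IsFlow raw

-- Some vertices and edges of A are deleted, k new vertices are created,
-- and the ends of each surviving edge are redirected to an old end or a new vertex.

data Tgt (n k : ℕ) : Set where
  old : Maybe (Fin n) → Tgt n k
  new : Fin k → Tgt n k

record Surgery (A : Raw) : Set where
  open Raw A
  field
    delV    : Fin nV → Bool
    delE    : Fin nE → Bool
    k       : ℕ
    newKind : Fin k → Kind
    upT     : Fin nE → Tgt nV k
    downT   : Fin nE → Tgt nV k

module _ {nA nB k : ℕ} (g : Fin nB → Fin nA ⊎ Fin k) where
  Corresp : Maybe (Fin nB) → Tgt nA k → Set
  Corresp nothing  (old nothing)  = ⊤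
  Corresp (just b) (old (just a)) = g b ≡ inj₁ a
  Corresp (just b) (new i)        = g b ≡ inj₂ i
  Corresp _        _              = ⊥

-- B is (up to isomorphism) the result of performing the surgery S on A
record Result (A : Raw) (S : Surgery A) (B : Raw) : Set where
  private
    module A = Raw A
    module B = Raw B
    module S = Surgery S
  field
    gV       : Fin B.nV → Fin A.nV ⊎ Fin S.k
    gV-inj   : Injective _≡_ _≡_ gV
    gV-keep  : ∀ x v → gV x ≡ inj₁ v → S.delV v ≡ false
    gV-onto₁ : ∀ v → S.delV v ≡ false → ∃ λ x → gV x ≡ inj₁ v
    gV-onto₂ : ∀ i → ∃ λ x → gV x ≡ inj₂ i
    kind-ok  : ∀ x → B.kind x ≡ [ A.kind , S.newKind ] (gV x)
    gE       : Fin B.nE → Fin A.nE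
    gE-inj   : Injective _≡_ _≡_ gE
    gE-keep  : ∀ x → S.delE (gE x) ≡ false
    gE-onto  : ∀ e → S.delE e ≡ false → ∃ λ x → gE x ≡ e
    pol-ok   : ∀ x → B.pol x ≡ A.pol (gE x)
    up-ok    : ∀ x → Corresp gV (B.up x) (S.upT (gE x))
    down-ok  : ∀ x → Corresp gV (B.down x) (S.downT (gE x))

module _ (A : Raw) where
  open Raw A

  is : ∀ {n} → Fin n → Fin n → Bool
  is x y = ⌊ x ≟ y ⌋

  data Redex : Set where
    r1 : (w c : Fin nV) (a b d : Fin nE) → kind w ≡ weakening → kind c ≡ contraction →
         up a ≡ just w → down a ≡ just c → down b ≡ just c → a ≢ b → up d ≡ just c → Redex
    r2 : (k u : Fin nV) (a b d : Fin nE) → kind k ≡ cocontraction → kind u ≡ coweakening →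
         up a ≡ just k → down a ≡ just u → up b ≡ just k → a ≢ b → down d ≡ just k → Redex
    r3 : (w c : Fin nV) (a b : Fin nE) → kind w ≡ weakening → kind c ≡ cointeraction →
         up a ≡ just w → down a ≡ just c → down b ≡ just c → a ≢ b → Redex
    r4 : (i u : Fin nV) (a b : Fin nE) → kind i ≡ interaction → kind u ≡ coweakening →
         up a ≡ just i → down a ≡ just u → up b ≡ just i → a ≢ b → Redex
    r5 : (w u : Fin nV) (a : Fin nE) → kind w ≡ weakening → kind u ≡ coweakening →
         up a ≡ just w → down a ≡ just u → Redex
    r6 : (w k : Fin nV) (a b c : Fin nE) → kind w ≡ weakening → kind k ≡ cocontraction →
         up a ≡ just w → down a ≡ just k → up b ≡ just k → up c ≡ just k → b ≢ c → Redex
    r7 : (c u : Fin nV) (a b d : Fin nE) → kind c ≡ contraction → kind u ≡ coweakening →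
         up a ≡ just c → down a ≡ just u → down b ≡ just c → down d ≡ just c → b ≢ d → Redex

  noKind : Fin 0 → Kind
  noKind ()

  surgery : Redex → Surgery A
  surgery (r1 w c a b d _ _ _ _ _ _ _) = record
    { delV = λ v → is v w ∨ is v c ; delE = λ e → is e a ∨ is e d
    ; k = 0 ; newKind = noKind
    ; upT = λ e → old (up e)
    ; downT = λ e → if is e b then old (down d) else old (down e) }
  surgery (r2 k u a b d _ _ _ _ _ _ _) = record
    { delV = λ v → is v k ∨ is v u ; delE = λ e → is e a ∨ is e d
    ; k = 0 ; newKind = noKind
    ; upT = λ e → if is e b then old (up d) else old (up e)
    ; downT = λ e → old (down e) }
  surgery (r3 w c a b _ _ _ _ _ _) = record
    { delV = λ v → is v w ∨ is v c ; delE = λ e → is e a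
    ; k = 1 ; newKind = λ _ → coweakening
    ; upT = λ e → old (up e)
    ; downT = λ e → if is e b then new zero else old (down e) }
  surgery (r4 i u a b _ _ _ _ _ _) = record
    { delV = λ v → is v i ∨ is v u ; delE = λ e → is e a
    ; k = 1 ; newKind = λ _ → weakening
    ; upT = λ e → if is e b then new zero else old (up e)
    ; downT = λ e → old (down e) }
  surgery (r5 w u a _ _ _ _) = record
    { delV = λ v → is v w ∨ is v u ; delE = λ e → is e a
    ; k = 0 ; newKind = noKind
    ; upT = λ e → old (up e)
    ; downT = λ e → old (down e) }
  surgery (r6 w k a b c _ _ _ _ _ _ _) = record
    { delV = λ v → is v w ∨ is v k ; delE = λ e → is e a
    ; k = 2 ; newKind = λ _ → weakening
    ; upT = λ e → if is e b then new zero else (if is e c then new (suc zero) else old (up e))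
    ; downT = λ e → old (down e) }
  surgery (r7 c u a b d _ _ _ _ _ _ _) = record
    { delV = λ v → is v c ∨ is v u ; delE = λ e → is e a
    ; k = 2 ; newKind = λ _ → coweakening
    ; upT = λ e → old (up e)
    ; downT = λ e → if is e b then new zero else (if is e d then new (suc zero) else old (down e)) }

_→w_ : Flow → Flow → Set
A →w B = Σ (Redex (Flow.raw A)) λ r → Result (Flow.raw A) (surgery (Flow.raw A) r) (Flow.raw B)

_→w⋆_ : Flow → Flow → Set
_→w⋆_ = Star _→w_

module Submission where

-- We argue backwards: every ai-cycle of the result B of one rewriting step
-- is the image of an ai-cycle of A.  Each rule deletes a weakening or
-- coweakening together with its neighbour, possibly merges two edges into one,
-- and possibly creates fresh weakenings/coweakenings.  Hence every edge of B
-- is realised in A by a "segment" of one or two consecutive edges, segments of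
-- distinct edges are disjoint, surviving vertices keep their kind, and every
-- fresh vertex carries a single edge, so no ai-path can pass through it.

open import Defs
open import Data.Nat using (ℕ)
open import Data.Fin using (Fin; zero; suc; _≟_)
open import Data.Bool using (false; _∨_; if_then_else_)
open import Data.Bool.Properties using (∨-zeroʳ)
open import Data.Maybe using (Maybe; just; nothing)
open import Data.Product using (∃; _×_; _,_; proj₁; proj₂)
open import Data.Sum using (_⊎_; inj₁; inj₂; [_,_]; isInj₁)
open import Data.Empty using (⊥; ⊥-elim)
open import Data.Unit using (⊤; tt)
open import Function using (_∘_)
open import Relation.Nullary using (¬_; yes; no)
open import Relation.Nullary.Decidable using (⌊_⌋)
open import Relation.Binary.PropositionalEquality
  using (_≡_; _≢_; refl; sym; trans; cong; subst)
open import Relation.Binary.Construct.Closure.ReflexiveTransitive using (ε; _◅_)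
open import Data.List using (List; []; _∷_; _++_; map; concatMap; last)
open import Data.List.Properties using (++-identityʳ; map-concatMap)
open import Data.List.NonEmpty as List⁺ using (List⁺; _∷_; toList)
open import Data.List.Relation.Unary.Linked using (Linked; []; [-]; _∷_)
open import Data.List.Relation.Unary.Linked.Properties as Linked using ()
open import Data.Maybe.Relation.Binary.Connected using (Connected; just; just-nothing)
open import Data.List.Relation.Unary.All as All using ([]; _∷_)
open import Data.List.Relation.Unary.All.Properties as All using ()
open import Data.List.Relation.Unary.AllPairs as AllPairs using ([]; _∷_)
open import Data.List.Relation.Unary.AllPairs.Properties as AllPairs using ()
open import Data.List.Relation.Unary.Any using (here; there)
open import Data.List.Relation.Unary.Unique.Propositional using (Unique)
open import Data.List.Relation.Unary.Unique.Propositional.Properties using (concat⁺)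
open import Data.List.Membership.Propositional using (_∈_)
open import Data.List.Membership.Propositional.Properties using (∈-map⁺)

unique-concatMap : {X Y K : Set} (key : X → K) (f : X → List Y) →
  (∀ x → Unique (f x)) →
  (∀ {x x' y} → y ∈ f x → y ∈ f x' → key x ≡ key x') →
  ∀ {xs} → Unique (map key xs) → Unique (concatMap f xs)
unique-concatMap key f unique-pieces shared {xs} keys-unique =
  concat⁺ (All.map⁺ (All.universal unique-pieces xs))
          (AllPairs.map⁺ (AllPairs.map (λ k≢k' {_} (y∈ , y∈') → k≢k' (shared y∈ y∈'))
                                       (AllPairs.map⁻ keys-unique)))

module _ (A : Raw) where
  open Raw A

  lastStep-∈ : ∀ s ss → lastStep A s ss ∈ s ∷ ss
  lastStep-∈ s []       = here refl
  lastStep-∈ s (t ∷ ts) = there (lastStep-∈ t ts)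

  lastStep-last : ∀ s ss → last (s ∷ ss) ≡ just (lastStep A s ss)
  lastStep-last s []       = refl
  lastStep-last s (t ∷ ts) = lastStep-last t ts

  lastStep-++ : ∀ s ss t ts → lastStep A s (ss ++ t ∷ ts) ≡ lastStep A t ts
  lastStep-++ s []        t ts = refl
  lastStep-++ s (s' ∷ ss) t ts = lastStep-++ s' ss t ts

  final : List⁺ (Step A) → Step A
  final (s ∷ ss) = lastStep A s ss

  -- A segment is a downward path of one edge, or of two edges, the first
  -- directly above the second; it realises one edge of a rewritten flow.
  data Segment : Set where
    single : Fin nE → Segment
    double : Fin nE → Fin nE → Segment

  top bottom : Segment → Fin nE
  top (single e)   = e
  top (double e _) = e
  bottom (single e)   = e
  bottom (double _ f) = f

  edges : Segment → List (Fin nE)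
  edges (single e)   = e ∷ []
  edges (double e f) = e ∷ f ∷ []

  Chain : Segment → Set
  Chain (single _)   = ⊤
  Chain (double e f) = e ≢ f × ∃ λ m → down e ≡ just m × up f ≡ just m

  entry exit : Segment → Dir A → Maybe (Fin nV)
  entry s ↓ = up (top s)
  entry s ↑ = down (bottom s)
  exit s ↓ = down (bottom s)
  exit s ↑ = up (top s)

  walk : Segment → Dir A → List⁺ (Step A)
  walk (single e)   d = (e , d) ∷ []
  walk (double e f) ↓ = (e , ↓) ∷ (f , ↓) ∷ []
  walk (double e f) ↑ = (f , ↑) ∷ (e , ↑) ∷ []

  walk-src : ∀ s d → src A (List⁺.head (walk s d)) ≡ entry s d
  walk-src (single e)   ↓ = refl
  walk-src (single e)   ↑ = refl
  walk-src (double e f) ↓ = refl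
  walk-src (double e f) ↑ = refl

  walk-tgt : ∀ s d → tgt A (final (walk s d)) ≡ exit s d
  walk-tgt (single e)   ↓ = refl
  walk-tgt (single e)   ↑ = refl
  walk-tgt (double e f) ↓ = refl
  walk-tgt (double e f) ↑ = refl

  walk-head-dir : ∀ s d → proj₂ (List⁺.head (walk s d)) ≡ d
  walk-head-dir (single e)   d = refl
  walk-head-dir (double e f) ↓ = refl
  walk-head-dir (double e f) ↑ = refl

  walk-final-dir : ∀ s d → proj₂ (final (walk s d)) ≡ d
  walk-final-dir (single e)   d = refl
  walk-final-dir (double e f) ↓ = refl
  walk-final-dir (double e f) ↑ = refl

  walk-linked : ∀ s d → Chain s → Linked (Link A) (toList (walk s d))
  walk-linked (single e)   d _               = [-]
  walk-linked (double e f) ↓ (_ , m , p , q) = (m , p , q , inj₁ refl) ∷ [-]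
  walk-linked (double e f) ↑ (_ , m , p , q) = (m , q , p , inj₁ refl) ∷ [-]

  walk-unique : ∀ s d → Chain s → Unique (map proj₁ (toList (walk s d)))
  walk-unique (single e)   d _         = [] ∷ []
  walk-unique (double e f) ↓ (e≢f , _) = (e≢f ∷ []) ∷ [] ∷ []
  walk-unique (double e f) ↑ (e≢f , _) = ((e≢f ∘ sym) ∷ []) ∷ [] ∷ []

  walk-edges : ∀ s d {e} → e ∈ map proj₁ (toList (walk s d)) → e ∈ edges s
  walk-edges (single e)   d m                  = m
  walk-edges (double e f) ↓ m                  = m
  walk-edges (double e f) ↑ (here p)           = there (here p)
  walk-edges (double e f) ↑ (there (here p))   = here p
  walk-edges (double e f) ↑ (there (there ()))

  walk-head-edge : ∀ s d → proj₁ (List⁺.head (walk s d)) ∈ edges s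
  walk-head-edge s d = walk-edges s d (here refl)

  walk-final-edge : ∀ s d → proj₁ (final (walk s d)) ∈ edges s
  walk-final-edge s d = walk-edges s d (∈-map⁺ proj₁ (lastStep-∈ (List⁺.head (walk s d)) (List⁺.tail (walk s d))))

  LinkShape : Fin nV → Step A → Step A → Set
  LinkShape ν (e , d) (e' , d') =
      (d ≡ d')
    ⊎ (d ≡ ↓ × d' ≡ ↑ × kind ν ≡ cointeraction × e ≢ e')
    ⊎ (d ≡ ↑ × d' ≡ ↓ × kind ν ≡ interaction × e ≢ e')

-- A simulation of B in A: vertices of B are old vertices of A of the same
-- kind or fresh leaves (all their incident edges coincide), and each edge of
-- B is realised by a chain in A joining the images of its ends; chains of
-- distinct edges share no edge.
record Simulation (A B : Raw) : Set where
  private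
    module A = Raw A
    module B = Raw B
  field
    vertex         : Fin B.nV → Maybe (Fin A.nV)
    kind-preserved : ∀ {ν μ} → vertex ν ≡ just μ → B.kind ν ≡ A.kind μ
    leaf           : ∀ {ν} → vertex ν ≡ nothing → ∀ {x x'} → Incident B x ν → Incident B x' ν → x ≡ x'
    segment        : Fin B.nE → Segment A
    chain          : ∀ x → Chain A (segment x)
    up-end         : ∀ {x ν μ} → B.up x ≡ just ν → vertex ν ≡ just μ → A.up (top A (segment x)) ≡ just μ
    down-end       : ∀ {x ν μ} → B.down x ≡ just ν → vertex ν ≡ just μ → A.down (bottom A (segment x)) ≡ just μ
    disjoint       : ∀ {x x' e} → e ∈ edges A (segment x) → e ∈ edges A (segment x') → x ≡ x'

-- Along a simulation, every ai-cycle of an acyclic B pulls back to A: each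
-- step of the cycle is replaced by the walk of its segment.
module Replay {A B : Raw} (sim : Simulation A B) (acyclic : ∀ v → ¬ (_⇝_ B v v)) where
  open Simulation sim

  dir : Dir B → Dir A
  dir ↓ = ↓
  dir ↑ = ↑

  replay : Step B → List⁺ (Step A)
  replay (x , d) = walk A (segment x) (dir d)

  replay-src : ∀ {s ν μ} → src B s ≡ just ν → vertex ν ≡ just μ → src A (List⁺.head (replay s)) ≡ just μ
  replay-src {x , ↓} p q = trans (walk-src A (segment x) ↓) (up-end p q)
  replay-src {x , ↑} p q = trans (walk-src A (segment x) ↑) (down-end p q)

  replay-tgt : ∀ {s ν μ} → tgt B s ≡ just ν → vertex ν ≡ just μ → tgt A (final A (replay s)) ≡ just μ
  replay-tgt {x , ↓} p q = trans (walk-tgt A (segment x) ↓) (down-end p q)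
  replay-tgt {x , ↑} p q = trans (walk-tgt A (segment x) ↑) (up-end p q)

  src-incident : ∀ s {ν} → src B s ≡ just ν → Incident B (proj₁ s) ν
  src-incident (x , ↓) p = inj₁ p
  src-incident (x , ↑) p = inj₂ p

  tgt-incident : ∀ s {ν} → tgt B s ≡ just ν → Incident B (proj₁ s) ν
  tgt-incident (x , ↓) p = inj₂ p
  tgt-incident (x , ↑) p = inj₁ p

  no-loop : ∀ s {ν} → src B s ≡ just ν → tgt B s ≡ just ν → ⊥
  no-loop (x , ↓) {ν} p q = acyclic ν (edge x p q)
  no-loop (x , ↑) {ν} p q = acyclic ν (edge x q p)

  ¬self-link : ∀ {x d d' ν} → tgt B (x , d) ≡ just ν → src B (x , d') ≡ just ν → ¬ LinkShape B ν (x , d) (x , d')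
  ¬self-link {x} {d} t s (inj₁ refl)             = no-loop (x , d) s t
  ¬self-link t s (inj₂ (inj₁ (_ , _ , _ , x≢x))) = x≢x refl
  ¬self-link t s (inj₂ (inj₂ (_ , _ , _ , x≢x))) = x≢x refl

  final-dir : ∀ x d → proj₂ (final A (replay (x , d))) ≡ dir d
  final-dir x d = walk-final-dir A (segment x) (dir d)

  head-dir : ∀ x d → proj₂ (List⁺.head (replay (x , d))) ≡ dir d
  head-dir x d = walk-head-dir A (segment x) (dir d)

  replay-distinct : ∀ {x d x' d'} → x ≢ x' →
                    proj₁ (final A (replay (x , d))) ≢ proj₁ (List⁺.head (replay (x' , d')))
  replay-distinct {x} {d} {x'} {d'} x≢x' same =
    x≢x' (disjoint (walk-final-edge A (segment x) (dir d))
                   (subst (_∈ _) (sym same) (walk-head-edge A (segment x') (dir d'))))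

  replay-shape : ∀ {x d x' d' ν μ} → vertex ν ≡ just μ → LinkShape B ν (x , d) (x' , d') →
                 LinkShape A μ (final A (replay (x , d))) (List⁺.head (replay (x' , d')))
  replay-shape {x} {d} {x'} {d'} v (inj₁ d≡d') =
    inj₁ (trans (final-dir x d) (trans (cong dir d≡d') (sym (head-dir x' d'))))
  replay-shape {x} {d} {x'} {d'} v (inj₂ (inj₁ (d↓ , d'↑ , k , x≢x'))) =
    inj₂ (inj₁ ( trans (final-dir x d) (cong dir d↓) , trans (head-dir x' d') (cong dir d'↑)
               , trans (sym (kind-preserved v)) k , replay-distinct x≢x'))
  replay-shape {x} {d} {x'} {d'} v (inj₂ (inj₂ (d↑ , d'↓ , k , x≢x'))) =
    inj₂ (inj₂ ( trans (final-dir x d) (cong dir d↑) , trans (head-dir x' d') (cong dir d'↓)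
               , trans (sym (kind-preserved v)) k , replay-distinct x≢x'))

  replay-link : ∀ {s s'} → Link B s s' → Link A (final A (replay s)) (List⁺.head (replay s'))
  replay-link {x , d} {x' , d'} (ν , t , s , shape) with vertex ν in v
  ... | just μ  = μ , replay-tgt t v , replay-src s v , replay-shape v shape
  ... | nothing with leaf v (tgt-incident (x , d) t) (src-incident (x' , d') s)
  ...   | refl = ⊥-elim (¬self-link t s shape)

  replayAll : List (Step B) → List (Step A)
  replayAll = concatMap (toList ∘ replay)

  replay-linked : ∀ s → Linked (Link A) (toList (replay s))
  replay-linked (x , d) = walk-linked A (segment x) (dir d) (chain x)

  -- the last element of a replayed step, in the sense of Data.List.last, is its final step
  connect : ∀ s {m} → Connected (Link A) (just (final A (replay s))) m →
            Connected (Link A) (last (toList (replay s))) m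
  connect s = subst (λ l → Connected (Link A) l _)
                    (sym (lastStep-last A (List⁺.head (replay s)) (List⁺.tail (replay s))))

  replayAll-linked : ∀ {s ss} → Linked (Link B) (s ∷ ss) → Linked (Link A) (replayAll (s ∷ ss))
  replayAll-linked {s} {[]}     _       = Linked.++⁺ (replay-linked s) (connect s just-nothing) []
  replayAll-linked {s} {s' ∷ _} (r ∷ l) =
    Linked.++⁺ (replay-linked s) (connect s (just (replay-link r))) (replayAll-linked l)

  replayAll-final : ∀ s ss → lastStep A (List⁺.head (replay s)) (List⁺.tail (replay s) ++ replayAll ss)
                             ≡ final A (replay (lastStep B s ss))
  replayAll-final s [] = cong (lastStep A (List⁺.head (replay s))) (++-identityʳ (List⁺.tail (replay s)))
  replayAll-final s (s' ∷ ss) =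
    trans (lastStep-++ A (List⁺.head (replay s)) (List⁺.tail (replay s))
                         (List⁺.head (replay s')) (List⁺.tail (replay s') ++ replayAll ss))
          (replayAll-final s' ss)

  -- since segments are disjoint chains, no edge is repeated by the replay
  replayAll-unique : ∀ {ss} → Unique (map proj₁ ss) → Unique (map proj₁ (replayAll ss))
  replayAll-unique {ss} u =
    subst Unique (sym (map-concatMap proj₁ (toList ∘ replay) ss))
          (unique-concatMap proj₁ (map proj₁ ∘ toList ∘ replay)
             (λ { (x , d) → walk-unique A (segment x) (dir d) (chain x) })
             (λ { {x , d} {x' , d'} m m' → disjoint (walk-edges A (segment x) (dir d) m)
                                                    (walk-edges A (segment x') (dir d') m') })
             u)

  -- an ai-cycle cannot be based at a fresh leaf: its first and last edge would coincide
  ¬leaf-cycle : (c : AiCycle B) → vertex (AiCycle.ν c) ≡ nothing → ⊥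
  ¬leaf-cycle c v = closes rest noRep ends
    where
    open AiCycle c
    closes : ∀ rs → Unique (map proj₁ (first ∷ rs)) → tgt B (lastStep B first rs) ≡ just ν → ⊥
    closes []       _              e = no-loop first starts e
    closes (r ∷ rs) (first∉rs ∷ _) e =
      All.lookup first∉rs (∈-map⁺ proj₁ (lastStep-∈ B r rs))
                 (leaf v (src-incident first starts) (tgt-incident (lastStep B r rs) e))

  pullback : AiCycle B → AiCycle A
  pullback c with vertex (AiCycle.ν c) in v
  ... | nothing = ⊥-elim (¬leaf-cycle c v)
  ... | just μ  = record
    { ν      = μ
    ; first  = List⁺.head (replay first)
    ; rest   = List⁺.tail (replay first) ++ replayAll rest
    ; linked = replayAll-linked linked
    ; starts = replay-src starts v
    ; ends   = subst (λ s → tgt A s ≡ just μ) (sym (replayAll-final first rest))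
                     (replay-tgt ends v)
    ; noRep  = replayAll-unique noRep }
    where open AiCycle c

module _ {nA nB k : ℕ} (g : Fin nB → Fin nA ⊎ Fin k) where

  corresp-old : ∀ {ν μ t} → Corresp g (just ν) t → g ν ≡ inj₁ μ → t ≡ old (just μ)
  corresp-old {t = old (just a)} c q with trans (sym c) q
  ... | refl = refl
  corresp-old {t = new i} c q with trans (sym c) q
  ... | ()

  corresp-new : ∀ {ν i t} → Corresp g (just ν) t → g ν ≡ inj₂ i → t ≡ new i
  corresp-new {t = old (just a)} c q with trans (sym c) q
  ... | ()
  corresp-new {t = new j} c q with trans (sym c) q
  ... | refl = refl

isInj₁-just : ∀ {X Y : Set} {v : X ⊎ Y} {x : X} → isInj₁ v ≡ just x → v ≡ inj₁ x
isInj₁-just {v = inj₁ _} refl = refl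

isInj₁-nothing : ∀ {X Y : Set} {v : X ⊎ Y} → isInj₁ v ≡ nothing → ∃ λ y → v ≡ inj₂ y
isInj₁-nothing {v = inj₂ y} refl = y , refl

record Replayable {A : Raw} (S : Surgery A) : Set where
  private
    module A = Raw A
    module S = Surgery S
  field
    segment    : Fin A.nE → Segment A
    chain      : ∀ {e} → S.delE e ≡ false → Chain A (segment e)
    up-end     : ∀ {e μ} → S.delE e ≡ false → S.upT e ≡ old (just μ) → A.up (top A (segment e)) ≡ just μ
    down-end   : ∀ {e μ} → S.delE e ≡ false → S.downT e ≡ old (just μ) → A.down (bottom A (segment e)) ≡ just μ
    disjoint   : ∀ {e e' f} → S.delE e ≡ false → S.delE e' ≡ false →
                 f ∈ edges A (segment e) → f ∈ edges A (segment e') → e ≡ e'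
    attachment : Fin S.k → Fin A.nE
    attached   : ∀ {e i} → S.upT e ≡ new i ⊎ S.downT e ≡ new i → e ≡ attachment i

simulation : ∀ {A B : Raw} {S : Surgery A} → Result A S B → Replayable S → Simulation A B
simulation {A} {B} {S} R P = record
  { vertex         = isInj₁ ∘ gV
  ; kind-preserved = λ {ν} v → trans (kind-ok ν) (cong [ Raw.kind A , Surgery.newKind S ] (isInj₁-just v))
  ; leaf           = leaf
  ; segment        = segment ∘ gE
  ; chain          = λ x → chain (gE-keep x)
  ; up-end         = λ {x} p v → up-end (gE-keep x) (corresp-old gV (up-at p) (isInj₁-just v))
  ; down-end       = λ {x} p v → down-end (gE-keep x) (corresp-old gV (down-at p) (isInj₁-just v))
  ; disjoint       = λ {x} {x'} m m' → gE-inj (disjoint (gE-keep x) (gE-keep x') m m')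
  }
  where
  open Result R
  open Replayable P
  module B = Raw B

  up-at : ∀ {x ν} → B.up x ≡ just ν → Corresp gV (just ν) (Surgery.upT S (gE x))
  up-at {x} p = subst (λ m → Corresp gV m (Surgery.upT S (gE x))) p (up-ok x)

  down-at : ∀ {x ν} → B.down x ≡ just ν → Corresp gV (just ν) (Surgery.downT S (gE x))
  down-at {x} p = subst (λ m → Corresp gV m (Surgery.downT S (gE x))) p (down-ok x)

  at-fresh : ∀ {x ν i} → gV ν ≡ inj₂ i → Incident B x ν → gE x ≡ attachment i
  at-fresh q (inj₁ p) = attached (inj₁ (corresp-new gV (up-at p) q))
  at-fresh q (inj₂ p) = attached (inj₂ (corresp-new gV (down-at p) q))

  leaf : ∀ {ν} → isInj₁ (gV ν) ≡ nothing → ∀ {x x'} → Incident B x ν → Incident B x' ν → x ≡ x'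
  leaf v i i' with isInj₁-nothing v
  ... | _ , q = gE-inj (trans (at-fresh q i) (sym (at-fresh q i')))

old-injective : ∀ {n k} {m m' : Maybe (Fin n)} → old {n} {k} m ≡ old m' → m ≡ m'
old-injective refl = refl

if-old : ∀ {n k p} {e b : Fin p} {j : Fin k} {t : Tgt n k} {m : Maybe (Fin n)} →
         (if ⌊ e ≟ b ⌋ then new j else t) ≡ old m → t ≡ old m
if-old {e = e} {b} q with e ≟ b
... | yes _ with q
...   | ()
if-old q | no _ = q

if-new : ∀ {n k p} {e b : Fin p} {j i : Fin k} {t : Tgt n k} →
         (if ⌊ e ≟ b ⌋ then new j else t) ≡ new i → (e ≡ b × j ≡ i) ⊎ t ≡ new i
if-new {e = e} {b} q with e ≟ b
if-new refl | yes e≡b = inj₁ (e≡b , refl)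
if-new q    | no _    = inj₂ q

kept-≢ : ∀ {n} {e e₀ d : Fin n} → ⌊ e ≟ e₀ ⌋ ∨ ⌊ e ≟ d ⌋ ≡ false → e ≢ d
kept-≢ {e = e} {e₀} q refl with e ≟ e
... | yes _ with trans (sym (∨-zeroʳ ⌊ e ≟ e₀ ⌋)) q
...   | ()
kept-≢ q refl | no e≢e = e≢e refl

replayable-single : ∀ {A : Raw} {S : Surgery A} (attachment : Fin (Surgery.k S) → Fin (Raw.nE A)) →
  (∀ {e μ} → Surgery.upT S e ≡ old (just μ) → Raw.up A e ≡ just μ) →
  (∀ {e μ} → Surgery.downT S e ≡ old (just μ) → Raw.down A e ≡ just μ) →
  (∀ {e i} → Surgery.upT S e ≡ new i ⊎ Surgery.downT S e ≡ new i → e ≡ attachment i) →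
  Replayable S
replayable-single attachment up-end down-end attached = record
  { segment    = single
  ; chain      = λ _ → tt
  ; up-end     = λ _ → up-end
  ; down-end   = λ _ → down-end
  ; disjoint   = λ { _ _ (here refl) (here refl) → refl }
  ; attachment = attachment
  ; attached   = attached }

extended-disjoint : ∀ {X : Set} {b d e e' f : X} → e ≢ d → e' ≢ d →
  f ≡ e ⊎ (e ≡ b × f ≡ d) → f ≡ e' ⊎ (e' ≡ b × f ≡ d) → e ≡ e'
extended-disjoint _   _    (inj₁ refl)        (inj₁ refl)        = refl
extended-disjoint e≢d _    (inj₁ refl)        (inj₂ (_ , f≡d))   = ⊥-elim (e≢d f≡d)
extended-disjoint _   e'≢d (inj₂ (_ , refl))  (inj₁ refl)        = ⊥-elim (e'≢d refl)
extended-disjoint _   _    (inj₂ (refl , _))  (inj₂ (refl , _))  = refl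

-- the two fresh vertices of rules 6 and 7 are attached to the two given edges
choose : ∀ {X : Set} → X → X → Fin 2 → X
choose b c zero    = b
choose b c (suc _) = c

module _ (A : Raw) where
  open Raw A

  -- rule (1): the other upper edge b of the contraction absorbs its lower edge d
  replayable₁ : ∀ w c a b d kw kc pa pa' pb ab pd → Replayable (surgery A (r1 w c a b d kw kc pa pa' pb ab pd))
  replayable₁ _ c a b d _ _ _ _ pb _ pd = record
    { segment    = seg
    ; chain      = chain
    ; up-end     = up-end
    ; down-end   = down-end
    ; disjoint   = λ kept kept' m m' → extended-disjoint (kept-≢ kept) (kept-≢ kept') (members m) (members m')
    ; attachment = λ ()
    ; attached   = λ { {i = ()} } }
    where
    seg : Fin nE → Segment A
    seg e = if ⌊ e ≟ b ⌋ then double e d else single e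

    chain : ∀ {e} → ⌊ e ≟ a ⌋ ∨ ⌊ e ≟ d ⌋ ≡ false → Chain A (seg e)
    chain {e} kept with e ≟ b
    ... | yes refl = kept-≢ kept , c , pb , pd
    ... | no _     = tt

    up-end : ∀ {e μ} → ⌊ e ≟ a ⌋ ∨ ⌊ e ≟ d ⌋ ≡ false → old {k = 0} (up e) ≡ old (just μ) →
             up (top A (seg e)) ≡ just μ
    up-end {e} _ q with e ≟ b
    ... | yes _ = old-injective q
    ... | no _  = old-injective q

    down-end : ∀ {e μ} → ⌊ e ≟ a ⌋ ∨ ⌊ e ≟ d ⌋ ≡ false →
               (if ⌊ e ≟ b ⌋ then old {k = 0} (down d) else old (down e)) ≡ old (just μ) →
               down (bottom A (seg e)) ≡ just μ
    down-end {e} _ q with e ≟ b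
    ... | yes _ = old-injective q
    ... | no _  = old-injective q

    members : ∀ {e f} → f ∈ edges A (seg e) → f ≡ e ⊎ (e ≡ b × f ≡ d)
    members {e} m with e ≟ b
    members (here f≡e)         | yes _   = inj₁ f≡e
    members (there (here f≡d)) | yes e≡b = inj₂ (e≡b , f≡d)
    members (here f≡e)         | no _    = inj₁ f≡e

  -- rule (2): the other lower edge b of the cocontraction absorbs its upper edge d
  replayable₂ : ∀ k u a b d kk ku pa pa' pb ab pd → Replayable (surgery A (r2 k u a b d kk ku pa pa' pb ab pd))
  replayable₂ k _ a b d _ _ _ _ pb _ pd = record
    { segment    = seg
    ; chain      = chain
    ; up-end     = up-end
    ; down-end   = down-end
    ; disjoint   = λ kept kept' m m' → extended-disjoint (kept-≢ kept) (kept-≢ kept') (members m) (members m')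
    ; attachment = λ ()
    ; attached   = λ { {i = ()} } }
    where
    seg : Fin nE → Segment A
    seg e = if ⌊ e ≟ b ⌋ then double d e else single e

    chain : ∀ {e} → ⌊ e ≟ a ⌋ ∨ ⌊ e ≟ d ⌋ ≡ false → Chain A (seg e)
    chain {e} kept with e ≟ b
    ... | yes refl = kept-≢ kept ∘ sym , k , pd , pb
    ... | no _     = tt

    up-end : ∀ {e μ} → ⌊ e ≟ a ⌋ ∨ ⌊ e ≟ d ⌋ ≡ false →
             (if ⌊ e ≟ b ⌋ then old {k = 0} (up d) else old (up e)) ≡ old (just μ) →
             up (top A (seg e)) ≡ just μ
    up-end {e} _ q with e ≟ b
    ... | yes _ = old-injective q
    ... | no _  = old-injective q

    down-end : ∀ {e μ} → ⌊ e ≟ a ⌋ ∨ ⌊ e ≟ d ⌋ ≡ false → old {k = 0} (down e) ≡ old (just μ) →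
               down (bottom A (seg e)) ≡ just μ
    down-end {e} _ q with e ≟ b
    ... | yes _ = old-injective q
    ... | no _  = old-injective q

    members : ∀ {e f} → f ∈ edges A (seg e) → f ≡ e ⊎ (e ≡ b × f ≡ d)
    members {e} m with e ≟ b
    members (here f≡d)         | yes e≡b = inj₂ (e≡b , f≡d)
    members (there (here f≡e)) | yes _   = inj₁ f≡e
    members (here f≡e)         | no _    = inj₁ f≡e

  -- rule (3): the other upper edge b of the cointeraction ends in a fresh coweakening
  replayable₃ : ∀ w c a b kw kc pa pa' pb ab → Replayable (surgery A (r3 w c a b kw kc pa pa' pb ab))
  replayable₃ _ _ _ b _ _ _ _ _ _ = replayable-single (λ _ → b) old-injective (old-injective ∘ if-old) attached
    where
    attached : ∀ {e} {i : Fin 1} →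
               old (up e) ≡ new i ⊎ (if ⌊ e ≟ b ⌋ then new zero else old (down e)) ≡ new i → e ≡ b
    attached (inj₁ ())
    attached (inj₂ q) with if-new {j = zero} q
    ... | inj₁ (e≡b , _) = e≡b
    ... | inj₂ ()

  -- rule (4): the other lower edge b of the interaction starts at a fresh weakening
  replayable₄ : ∀ i u a b ki ku pa pa' pb ab → Replayable (surgery A (r4 i u a b ki ku pa pa' pb ab))
  replayable₄ _ _ _ b _ _ _ _ _ _ = replayable-single (λ _ → b) (old-injective ∘ if-old) old-injective attached
    where
    attached : ∀ {e} {i : Fin 1} →
               (if ⌊ e ≟ b ⌋ then new zero else old (up e)) ≡ new i ⊎ old (down e) ≡ new i → e ≡ b
    attached (inj₂ ())
    attached (inj₁ q) with if-new {j = zero} q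
    ... | inj₁ (e≡b , _) = e≡b
    ... | inj₂ ()

  -- rule (5): a weakening meeting a coweakening disappears with its edge
  replayable₅ : ∀ w u a kw ku pa pa' → Replayable (surgery A (r5 w u a kw ku pa pa'))
  replayable₅ _ _ _ _ _ _ _ = replayable-single (λ ()) old-injective old-injective (λ { {i = ()} })

  -- rule (6): the lower edges b, c of the cocontraction start at fresh weakenings
  replayable₆ : ∀ w k a b c kw kk pa pa' pb pc bc → Replayable (surgery A (r6 w k a b c kw kk pa pa' pb pc bc))
  replayable₆ _ _ _ b c _ _ _ _ _ _ _ =
    replayable-single (choose b c) (λ {e} → old-injective ∘ if-old {e = e} {c} ∘ if-old {e = e} {b})
                      old-injective attached
    where
    attached : ∀ {e} {i : Fin 2} →
               (if ⌊ e ≟ b ⌋ then new zero else (if ⌊ e ≟ c ⌋ then new (suc zero) else old (up e))) ≡ new i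
               ⊎ old (down e) ≡ new i → e ≡ choose b c i
    attached (inj₂ ())
    attached {e} (inj₁ q) with if-new {e = e} {b} q
    ... | inj₁ (e≡b , refl) = e≡b
    ... | inj₂ q' with if-new {e = e} {c} q'
    ...   | inj₁ (e≡c , refl) = e≡c
    ...   | inj₂ ()

  -- rule (7): the upper edges b, d of the contraction end in fresh coweakenings
  replayable₇ : ∀ c u a b d kc ku pa pa' pb pd bd → Replayable (surgery A (r7 c u a b d kc ku pa pa' pb pd bd))
  replayable₇ _ _ _ b d _ _ _ _ _ _ _ =
    replayable-single (choose b d) old-injective
                      (λ {e} → old-injective ∘ if-old {e = e} {d} ∘ if-old {e = e} {b}) attached
    where
    attached : ∀ {e} {i : Fin 2} →
               old (up e) ≡ new i
               ⊎ (if ⌊ e ≟ b ⌋ then new zero else (if ⌊ e ≟ d ⌋ then new (suc zero) else old (down e))) ≡ new i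
               → e ≡ choose b d i
    attached (inj₁ ())
    attached {e} (inj₂ q) with if-new {e = e} {b} q
    ... | inj₁ (e≡b , refl) = e≡b
    ... | inj₂ q' with if-new {e = e} {d} q'
    ...   | inj₁ (e≡d , refl) = e≡d
    ...   | inj₂ ()

  replayable : (r : Redex A) → Replayable (surgery A r)
  replayable (r1 w c a b d kw kc pa pa' pb ab pd) = replayable₁ w c a b d kw kc pa pa' pb ab pd
  replayable (r2 k u a b d kk ku pa pa' pb ab pd) = replayable₂ k u a b d kk ku pa pa' pb ab pd
  replayable (r3 w c a b kw kc pa pa' pb ab)      = replayable₃ w c a b kw kc pa pa' pb ab
  replayable (r4 i u a b ki ku pa pa' pb ab)      = replayable₄ i u a b ki ku pa pa' pb ab
  replayable (r5 w u a kw ku pa pa')              = replayable₅ w u a kw ku pa pa'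
  replayable (r6 w k a b c kw kk pa pa' pb pc bc) = replayable₆ w k a b c kw kk pa pa' pb pc bc
  replayable (r7 c u a b d kc ku pa pa' pb pd bd) = replayable₇ c u a b d kc ku pa pa' pb pd bd

reflect-cycle : (A B : Flow) → A →w B → AiCycle (Flow.raw B) → AiCycle (Flow.raw A)
reflect-cycle A B (r , R) =
  Replay.pullback (simulation R (replayable (Flow.raw A) r)) (IsFlow.acyclic (Flow.wf B))

proposition4p14 : (A B : Flow) → CycleFree (Flow.raw A) → A →w⋆ B → CycleFree (Flow.raw B)
proposition4p14 A .A cycle-free ε               = cycle-free
proposition4p14 A B  cycle-free (_◅_ {j = C} step steps) =
  proposition4p14 C B (cycle-free ∘ reflect-cycle A C step) steps
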